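{- Let $(\mathcal N,w)$ be a weighted normal network on $X$ and let $\{s,t\}\subseteq X$. Suppose $(\mathcal N',w')$ is obtained from $(\mathcal N,w)$ either by reducing $t$, where $\{s,t\}$ is a cherry, or by cutting $\{s,t\}$ or isolating $\{s,t\}$, where $\{s,t\}$ is a reticulated cherry with reticulation leaf $t$. Then $\mathcal N'$ is a normal network. Furthermore, if $w$ is an equidistant (respectively, reticulation-pair) weighting, then $w'$ is an equidistant (respectively, reticulation-pair) weighting.
   Context: A phylogenetic network on a non-empty finite set $X$ is a rooted acyclic directed graph without parallel edges whose root has out-degree two, whose vertices of out-degree zero (leaves) are exactly the elements of $X$ and have in-degree one, and all of whose other vertices are tree vertices (in-degree one, out-degree two) or reticulations (in-degree two, out-degree one); for $|X|=1$ the single vertex graph is allowed. Edges into reticulations are reticulation edges, others tree edges. An edge $(u,v)$ is a shortcut if some directed path from $u$ to $v$ avoids it. The network is tree-child if every non-leaf vertex is the parent of a tree vertex or leaf, and normal if tree-child with no shortcuts. A weighting assigns non-negative reals to edges, strictly positive on tree edges; it is equidistant if all root-to-leaf directed paths have the same total weight, and reticulation-pair if the two edges into each reticulation have equal weight. Let $p_s,p_t$ be the parents of $s,t$. $\{s,t\}$ is a cherry if $p_s=p_t$; it is a reticulated cherry with reticulation leaf $t$ if $p_t$ is a reticulation and $p_s$ is a parent of $p_t$. Reducing $t$ (for a cherry, with $g_s$ the parent of $p_s$): delete $t$ and its incident edge, suppress $p_s$, and give the resulting edge $(g_s,s)$ weight $w(g_s,p_s)+w(p_s,s)$. For a reticulated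 cherry with reticulation leaf $t$, let $g_s$ be the parent of $p_s$ and $g_t$ the parent of $p_t$ other than $p_s$. Cutting $\{s,t\}$: delete $(p_s,p_t)$, suppress $p_s$ and $p_t$, giving edge $(g_s,s)$ weight $w(g_s,p_s)+w(p_s,s)$ and edge $(g_t,t)$ weight $w(g_t,p_t)+w(p_t,t)$. Isolating $\{s,t\}$ (defined when $g_t$ is a tree vertex; let $g_t'$ be its parent and $h$ its child other than $p_t$): delete $(g_t,p_t)$, suppress $g_t$ and $p_t$, giving edge $(p_s,t)$ weight $w(p_s,p_t)+w(p_t,t)$ and edge $(g_t',h)$ weight $w(g_t',g_t)+w(g_t,h)$. All other edge weights are unchanged. -}

module Defs where

open import Level using (Level; _⊔_) renaming (suc to lsuc; zero to lzero)
open import Function using (_∘_)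
open import Data.Bool using (Bool; true; false; T; _∧_; _∨_; not; if_then_else_)
open import Data.Bool.Properties using (T-irrelevant)
open import Data.Maybe using (Maybe; just; nothing)
open import Data.Product using (Σ; _×_; _,_; proj₁; proj₂)
open import Data.Sum using (_⊎_)
open import Data.Empty using (⊥)
open import Data.List using (List)
open import Data.List.Membership.Propositional using (_∈_)
open import Relation.Nullary using (¬_; yes; no)
open import Relation.Nullary.Decidable using (⌊_⌋)
open import Relation.Binary.PropositionalEquality using (_≡_; _≢_; refl; cong)
open import Relation.Binary.Definitions using (DecidableEquality)
open import Relation.Binary.Core using (Rel; _Preserves₂_⟶_⟶_)
open import Relation.Binary.Structures using (IsPartialOrder)
open import Algebra.Structures using (IsCommutativeMonoid)

-- Weight domain: a partially ordered commutative monoid (x ≤ y ⇒ x+z ≤ y+z).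
-- The non-negative reals (indeed the reals) with + and ≤ are an instance.

record WeightDomain c ℓ₁ ℓ₂ : Set (lsuc (c ⊔ ℓ₁ ⊔ ℓ₂)) where
  infixl 7 _∙_
  infix  4 _≈_ _≤_ _<_
  field
    Carrier             : Set c
    _≈_                 : Rel Carrier ℓ₁
    _∙_                 : Carrier → Carrier → Carrier
    ε                   : Carrier
    isCommutativeMonoid : IsCommutativeMonoid _≈_ _∙_ ε
    _≤_                 : Rel Carrier ℓ₂
    isPartialOrder      : IsPartialOrder _≈_ _≤_
    ∙-mono-≤            : _∙_ Preserves₂ _≤_ ⟶ _≤_ ⟶ _≤_

  _<_ : Rel Carrier (ℓ₁ ⊔ ℓ₂)
  x < y = x ≤ y × ¬ (x ≈ y)

record Graph : Set₁ where
  field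
    V   : Set
    _≟_ : DecidableEquality V
    adj : V → V → Bool

module GraphDefs (G : Graph) where
  open Graph G

  _==_ : V → V → Bool
  u == v = ⌊ u ≟ v ⌋

  Edge : V → V → Set
  Edge u v = T (adj u v)

  Finite : Set
  Finite = Σ (List V) λ vs → ∀ v → v ∈ vs

  InDeg0 InDeg1 InDeg2 OutDeg0 OutDeg1 OutDeg2 : V → Set
  InDeg0 v = ∀ u → ¬ Edge u v
  InDeg1 v = Σ V λ u → Edge u v × (∀ u' → Edge u' v → u' ≡ u)
  InDeg2 v = Σ V λ u₁ → Σ V λ u₂ → u₁ ≢ u₂ × Edge u₁ v × Edge u₂ v
             × (∀ u → Edge u v → u ≡ u₁ ⊎ u ≡ u₂)
  OutDeg0 v = ∀ u → ¬ Edge v u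
  OutDeg1 v = Σ V λ u → Edge v u × (∀ u' → Edge v u' → u' ≡ u)
  OutDeg2 v = Σ V λ u₁ → Σ V λ u₂ → u₁ ≢ u₂ × Edge v u₁ × Edge v u₂
              × (∀ u → Edge v u → u ≡ u₁ ⊎ u ≡ u₂)

  IsLeaf IsTreeVertex IsReticulation : V → Set
  IsLeaf v = OutDeg0 v
  IsTreeVertex v = InDeg1 v × OutDeg2 v
  IsReticulation v = InDeg2 v × OutDeg1 v

  data Path : V → V → Set where
    []  : ∀ {u} → Path u u
    _∷_ : ∀ {u v x} → Edge u v → Path v x → Path u x

  Avoids : V → V → ∀ {u x} → Path u x → Set
  Avoids a b [] = Data.Unit.⊤ where import Data.Unit
  Avoids a b (_∷_ {u} {v} e p) = ¬ (u ≡ a × v ≡ b) × Avoids a b p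

  Acyclic : Set
  Acyclic = ∀ u v → Edge u v → ¬ Path v u

  IsShortcut : V → V → Set
  IsShortcut u v = Edge u v × Σ (Path u v) (Avoids u v)

  -- Phylogenetic network (on its set of leaves).  For a single leaf the
  -- one-vertex graph is allowed (root of out-degree zero).
  record IsPhylogeneticNetwork : Set where
    field
      finite   : Finite
      acyclic  : Acyclic
      root     : V
      root-in  : InDeg0 root
      root-out : OutDeg2 root ⊎ (OutDeg0 root × (∀ v → v ≡ root))
      classify : ∀ v → v ≡ root
                       ⊎ (IsLeaf v × InDeg1 v)
                       ⊎ IsTreeVertex v
                       ⊎ IsReticulation v

  IsTreeChild : Set
  IsTreeChild = ∀ v → ¬ IsLeaf v → Σ V λ c → Edge v c × (IsTreeVertex c ⊎ IsLeaf c)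

  IsNormal : Set
  IsNormal = IsPhylogeneticNetwork × IsTreeChild × (∀ u v → ¬ IsShortcut u v)

  -- edges into reticulations are reticulation edges, all others tree edges
  module Weights {c ℓ₁ ℓ₂} (M : WeightDomain c ℓ₁ ℓ₂) where
    open WeightDomain M

    pathWeight : (w : V → V → Carrier) → ∀ {u x} → Path u x → Carrier
    pathWeight w [] = ε
    pathWeight w (_∷_ {u} {v} e p) = w u v ∙ pathWeight w p

    record IsWeighting (w : V → V → Carrier) : Set (ℓ₁ ⊔ ℓ₂) where
      field
        nonneg   : ∀ u v → Edge u v → ε ≤ w u v
        tree-pos : ∀ u v → Edge u v → ¬ IsReticulation v → ε < w u v

    -- all root-to-leaf paths have the same total weight
    -- (the root is the unique vertex of in-degree zero)
    IsEquidistant : (w : V → V → Carrier) → Set ℓ₁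
    IsEquidistant w = ∀ r → InDeg0 r → ∀ l₁ l₂ → IsLeaf l₁ → IsLeaf l₂ →
      (p₁ : Path r l₁) (p₂ : Path r l₂) → pathWeight w p₁ ≈ pathWeight w p₂

    IsReticulationPair : (w : V → V → Carrier) → Set ℓ₁
    IsReticulationPair w = ∀ v → IsReticulation v → ∀ u₁ u₂ →
      Edge u₁ v → Edge u₂ v → w u₁ v ≈ w u₂ v

module _ (G : Graph) where
  open Graph G

  subDec : (keep : V → Bool) → DecidableEquality (Σ V (T ∘ keep))
  subDec keep (u , p) (v , q) with u ≟ v
  ... | yes refl = yes (cong (u ,_) (T-irrelevant p q))
  ... | no ne = no (λ eq → ne (cong proj₁ eq))

  rebuild : (keep : V → Bool) (adj' : V → V → Bool) → Graph
  rebuild keep adj' = record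
    { V   = Σ V (T ∘ keep)
    ; _≟_ = subDec keep
    ; adj = λ u v → adj' (proj₁ u) (proj₁ v) }

module Operations {c ℓ₁ ℓ₂} (M : WeightDomain c ℓ₁ ℓ₂) (G : Graph)
                  (w : Graph.V G → Graph.V G → WeightDomain.Carrier M) where
  open Graph G
  open GraphDefs G
  open WeightDomain M

  -- the (possibly absent) parent of a vertex: `nothing` means the vertex is the root
  ParentOf : Maybe V → V → Set
  ParentOf nothing  p = InDeg0 p
  ParentOf (just g) p = Edge g p

  newEdge : Maybe V → V → V → V → Bool
  newEdge nothing  b u v = false
  newEdge (just a) b u v = (u == a) ∧ (v == b)

  -- Reducing t in the cherry {s,t} with common parent ps, grandparent mgs
  reduceGraph : (s t ps : V) (mgs : Maybe V) → Graph
  reduceGraph s t ps mgs =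
    rebuild G (λ v → not ((v == t) ∨ (v == ps)))
              (λ u v → adj u v ∨ newEdge mgs s u v)

  reduceWeight : (s t ps : V) (mgs : Maybe V) →
    Graph.V (reduceGraph s t ps mgs) → Graph.V (reduceGraph s t ps mgs) → Carrier
  reduceWeight s t ps mgs (u , _) (v , _) with mgs
  ... | nothing = w u v
  ... | just gs = if (u == gs) ∧ (v == s) then w gs ps ∙ w ps s else w u v

  cutGraph : (s t ps pt gs gt : V) → Graph
  cutGraph s t ps pt gs gt =
    rebuild G (λ v → not ((v == ps) ∨ (v == pt)))
              (λ u v → adj u v ∨ ((u == gs) ∧ (v == s)) ∨ ((u == gt) ∧ (v == t)))

  cutWeight : (s t ps pt gs gt : V) →
    Graph.V (cutGraph s t ps pt gs gt) → Graph.V (cutGraph s t ps pt gs gt) → Carrier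
  cutWeight s t ps pt gs gt (u , _) (v , _) =
    if (u == gs) ∧ (v == s) then w gs ps ∙ w ps s
    else if (u == gt) ∧ (v == t) then w gt pt ∙ w pt t
    else w u v

  -- Isolating the reticulated cherry {s,t}; gt' parent of gt, h other child of gt
  isolateGraph : (s t ps pt gt gt' h : V) → Graph
  isolateGraph s t ps pt gt gt' h =
    rebuild G (λ v → not ((v == gt) ∨ (v == pt)))
              (λ u v → adj u v ∨ ((u == ps) ∧ (v == t)) ∨ ((u == gt') ∧ (v == h)))

  isolateWeight : (s t ps pt gt gt' h : V) →
    Graph.V (isolateGraph s t ps pt gt gt' h) → Graph.V (isolateGraph s t ps pt gt gt' h) → Carrier
  isolateWeight s t ps pt gt gt' h (u , _) (v , _) =
    if (u == ps) ∧ (v == t) then w ps pt ∙ w pt t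
    else if (u == gt') ∧ (v == h) then w gt' gt ∙ w gt h
    else w u v

  IsCherry : (s t ps : V) → Set
  IsCherry s t ps = IsLeaf s × IsLeaf t × s ≢ t × Edge ps s × Edge ps t

  IsReticulatedCherry : (s t ps pt : V) → Set
  IsReticulatedCherry s t ps pt =
    IsLeaf s × IsLeaf t × Edge ps s × Edge pt t × IsReticulation pt × Edge ps pt

  data ObtainedBy (s t : V) : (G' : Graph) → (Graph.V G' → Graph.V G' → Carrier) →
                  Set (lsuc lzero ⊔ c) where
    reduce : (ps : V) (mgs : Maybe V) →
      IsCherry s t ps → ParentOf mgs ps →
      ObtainedBy s t (reduceGraph s t ps mgs) (reduceWeight s t ps mgs)
    cut : (ps pt gs gt : V) →
      IsReticulatedCherry s t ps pt →
      Edge gs ps → Edge gt pt → gt ≢ ps →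
      ObtainedBy s t (cutGraph s t ps pt gs gt) (cutWeight s t ps pt gs gt)
    isolate : (ps pt gt gt' h : V) →
      IsReticulatedCherry s t ps pt →
      Edge gt pt → gt ≢ ps → IsTreeVertex gt →
      Edge gt' gt → Edge gt h → h ≢ pt →
      ObtainedBy s t (isolateGraph s t ps pt gt gt' h) (isolateWeight s t ps pt gt gt' h)

-- Every operation deletes a leaf or an edge and then suppresses the vertices left with
-- in- and out-degree one: a path a → m → b through a suppressed vertex m becomes an edge
-- a → b of weight w(a,m) + w(m,b).  In a normal network such an edge a → b was not present
-- before (it would be a shortcut), every surviving vertex keeps its in- and out-degree, and
-- paths of the new network lift to paths of the old one with the same weight.  Hence the
-- network axioms, tree-childness, the absence of shortcuts and equidistance all transfer.
-- Every new edge ends in a vertex of in-degree one, so the edges into reticulations, and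
-- with them the reticulation-pair property, are untouched.  The only exception is reducing
-- a cherry whose parent is the root: then the network is the cherry alone and becomes the
-- single-vertex network.
module Submission where

open import Defs
open import Level using (_⊔_)
open import Function using (_∘_)
open import Function.Bundles using (Equivalence)
open import Data.Bool using (Bool; true; false; T; _∧_; _∨_; not; if_then_else_)
open import Data.Bool.Properties using (T-irrelevant; T-∧; T-∨)
open import Data.Maybe using (just; nothing)
open import Data.Product using (Σ; _×_; _,_; proj₁; proj₂; uncurry)
open import Data.Sum using (_⊎_; inj₁; inj₂; map; map₂; swap)
open import Data.Empty using (⊥; ⊥-elim)
open import Data.Unit using (tt)
open import Data.Nat using (ℕ; zero; suc; _+_)
open import Data.Nat.Properties using (n<1+n; m≤n⇒∃[o]m+o≡n; +-comm)
open import Data.Fin using (Fin; toℕ)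
open import Data.Fin.Properties using (pigeonhole)
open import Data.List using (List; []; _∷_; length)
open import Data.List.Membership.Propositional using (_∈_)
open import Data.List.Relation.Unary.Any using (here; there; index)
open import Data.List.Membership.Setoid.Properties using (index-injective)
open import Relation.Nullary using (¬_; yes; no)
open import Relation.Nullary.Decidable using (T?; toWitness; fromWitness)
open import Relation.Binary.PropositionalEquality
  using (_≡_; _≢_; refl; sym; trans; cong; subst; setoid)
open import Relation.Binary.Structures using (IsPartialOrder)
open import Algebra.Structures using (IsCommutativeMonoid)

module Degree {A : Set} (P : A → Set) where

  None One Two : Set
  None = ∀ a → ¬ P a
  One  = Σ A λ u → P u × (∀ u' → P u' → u' ≡ u)
  Two  = Σ A λ u₁ → Σ A λ u₂ → u₁ ≢ u₂ × P u₁ × P u₂ × (∀ u → P u → u ≡ u₁ ⊎ u ≡ u₂)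

  One-unique : One → ∀ {a b} → P a → P b → a ≡ b
  One-unique (_ , _ , only) pa pb = trans (only _ pa) (sym (only _ pb))

  One⇒¬Two : One → ¬ Two
  One⇒¬Two one (_ , _ , u₁≢u₂ , p₁ , p₂ , _) = u₁≢u₂ (One-unique one p₁ p₂)

  Two-cases : Two → ∀ {a b c} → P a → P b → a ≢ b → P c → c ≡ a ⊎ c ≡ b
  Two-cases (_ , _ , _ , _ , _ , only) {a} {b} {c} pa pb a≢b pc
    with only a pa | only b pb | only c pc
  ... | inj₁ refl | inj₁ refl | _         = ⊥-elim (a≢b refl)
  ... | inj₂ refl | inj₂ refl | _         = ⊥-elim (a≢b refl)
  ... | inj₁ refl | inj₂ refl | inj₁ refl = inj₁ refl
  ... | inj₁ refl | inj₂ refl | inj₂ refl = inj₂ refl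
  ... | inj₂ refl | inj₁ refl | inj₁ refl = inj₂ refl
  ... | inj₂ refl | inj₁ refl | inj₂ refl = inj₁ refl

record Correspondence {A B : Set} (P : A → Set) (Q : B → Set) : Set where
  field
    to           : ∀ a → P a → B
    to-Q         : ∀ a p → Q (to a p)
    from         : ∀ b → Q b → A
    from-P       : ∀ b q → P (from b q)
    to∘from      : ∀ b q → to (from b q) (from-P b q) ≡ b
    to-injective : ∀ {a a'} p p' → to a p ≡ to a' p' → a ≡ a'
    P-irrelevant : ∀ {a} (p p' : P a) → p ≡ p'
    Q-irrelevant : ∀ {b} (q q' : Q b) → q ≡ q'

module _ {A B : Set} {P : A → Set} {Q : B → Set} (C : Correspondence P Q) where
  open Correspondence C

  private
    to-cong : ∀ {a a'} (p : P a) (p' : P a') → a ≡ a' → to a p ≡ to a' p'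
    to-cong p p' refl = cong (to _) (P-irrelevant p p')

  Correspondence-sym : Correspondence Q P
  Correspondence-sym = record
    { to = from ; to-Q = from-P ; from = to ; from-P = to-Q
    ; to∘from = λ a p → to-injective _ _ (to∘from (to a p) (to-Q a p))
    ; to-injective = λ {b} {b'} q q' eq →
        trans (sym (to∘from b q)) (trans (to-cong _ _ eq) (to∘from b' q'))
    ; P-irrelevant = Q-irrelevant ; Q-irrelevant = P-irrelevant }

  None-transport : Degree.None P → Degree.None Q
  None-transport none b q = none (from b q) (from-P b q)

  One-transport : Degree.One P → Degree.One Q
  One-transport (a , p , only) =
    to a p , to-Q a p , λ b q → trans (sym (to∘from b q)) (to-cong _ _ (only _ (from-P b q)))

  Two-transport : Degree.Two P → Degree.Two Q
  Two-transport (a₁ , a₂ , a₁≢a₂ , p₁ , p₂ , only) =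
    to a₁ p₁ , to a₂ p₂ , (λ eq → a₁≢a₂ (to-injective _ _ eq)) , to-Q _ _ , to-Q _ _ ,
    λ b q → back b q (only _ (from-P b q))
    where
    back : ∀ b q → from b q ≡ a₁ ⊎ from b q ≡ a₂ → b ≡ to a₁ p₁ ⊎ b ≡ to a₂ p₂
    back b q (inj₁ eq) = inj₁ (trans (sym (to∘from b q)) (to-cong _ _ eq))
    back b q (inj₂ eq) = inj₂ (trans (sym (to∘from b q)) (to-cong _ _ eq))

module WeightDomainProperties {c ℓ₁ ℓ₂} (M : WeightDomain c ℓ₁ ℓ₂) where
  open WeightDomain M
  open IsCommutativeMonoid isCommutativeMonoid public
    using (assoc; ∙-cong)
    renaming (refl to ≈-refl; reflexive to ≈-reflexive; sym to ≈-sym; trans to ≈-trans)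
  open IsCommutativeMonoid isCommutativeMonoid using (identityˡ)
  open IsPartialOrder isPartialOrder using (antisym; ≤-respˡ-≈; ≤-respʳ-≈) renaming (refl to ≤-refl)

  ε≤-resp-≈ : ∀ {x y} → ε ≤ x → y ≈ x → ε ≤ y
  ε≤-resp-≈ ε≤x y≈x = ≤-respʳ-≈ (≈-sym y≈x) ε≤x

  ε<-resp-≈ : ∀ {x y} → ε < x → y ≈ x → ε < y
  ε<-resp-≈ (ε≤x , ε≉x) y≈x = ε≤-resp-≈ ε≤x y≈x , λ ε≈y → ε≉x (≈-trans ε≈y y≈x)

  ∙-nonneg : ∀ {a b} → ε ≤ a → ε ≤ b → ε ≤ a ∙ b
  ∙-nonneg ε≤a ε≤b = ≤-respˡ-≈ (identityˡ ε) (∙-mono-≤ ε≤a ε≤b)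

  ∙-pos : ∀ {a b} → ε ≤ a → ε < b → ε < a ∙ b
  ∙-pos {a} {b} ε≤a (ε≤b , ε≉b) = ∙-nonneg ε≤a ε≤b , λ ε≈ab → ε≉b (antisym ε≤b (b≤ε ε≈ab))
    where
    b≤ε : ε ≈ a ∙ b → b ≤ ε
    b≤ε ε≈ab = ≤-respʳ-≈ (≈-sym ε≈ab) (≤-respˡ-≈ (identityˡ b) (∙-mono-≤ ε≤a ≤-refl))

if-T : ∀ {a} {A : Set a} {b} {x y : A} → T b → (if b then x else y) ≡ x
if-T {b = true} _ = refl

if-¬T : ∀ {a} {A : Set a} {b} {x y : A} → ¬ T b → (if b then x else y) ≡ y
if-¬T {b = false} _ = refl
if-¬T {b = true}  n = ⊥-elim (n tt)

Σ-≡ : ∀ {A : Set} {keep : A → Bool} {a a'} {p : T (keep a)} {p' : T (keep a')} →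
      a ≡ a' → _≡_ {A = Σ A (T ∘ keep)} (a , p) (a' , p')
Σ-≡ {p = p} {p'} refl = cong (_ ,_) (T-irrelevant p p')

-- N is the in- or out-neighbourhood of a kept vertex; after suppression every removed
-- neighbour m is replaced by the unique kept vertex beyond m.
module KeptNeighbours {V : Set} (keep : V → Bool)
  (N : V → Set) (N' : Σ V (T ∘ keep) → Set) (Beyond : V → V → Set)
  (N'⇒ : ∀ {x} (k : T (keep x)) → N' (x , k) →
         N x ⊎ Σ V λ m → ¬ T (keep m) × N m × Beyond m x)
  (N'⇐ : ∀ {x} (k : T (keep x)) →
         N x ⊎ Σ V (λ m → ¬ T (keep m) × N m × Beyond m x) → N' (x , k))
  (beyond-unique : ∀ {m} → ¬ T (keep m) → N m →
                   Σ V λ x → T (keep x) × Beyond m x × (∀ x' → T (keep x') → Beyond m x' → x' ≡ x))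
  (removed-unique : ∀ {m m'} → ¬ T (keep m) → ¬ T (keep m') → N m → N m' → m ≡ m')
  (no-triangle : ∀ {m x} → N m → Beyond m x → N x → ⊥)
  (N-irrelevant : ∀ {x} (p q : N x) → p ≡ q)
  (N'-irrelevant : ∀ {x} (p q : N' x) → p ≡ q)
  where

  private
    V' : Set
    V' = Σ V (T ∘ keep)

    beyond : ∀ {m} (r : ¬ T (keep m)) (n : N m) → Beyond m (proj₁ (beyond-unique r n))
    beyond r n = proj₁ (proj₂ (proj₂ (beyond-unique r n)))

    image : ∀ u → N u → V'
    image u n with T? (keep u)
    ... | yes k = u , k
    ... | no r  = proj₁ (beyond-unique r n) , proj₁ (proj₂ (beyond-unique r n))

    image-N' : ∀ u (n : N u) → N' (image u n)
    image-N' u n with T? (keep u)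
    ... | yes k = N'⇐ k (inj₁ n)
    ... | no r  = N'⇐ (proj₁ (proj₂ (beyond-unique r n))) (inj₂ (u , r , n , beyond r n))

    preimage : ∀ x → N' x → V
    preimage (x , k) n' with N'⇒ k n'
    ... | inj₁ _       = x
    ... | inj₂ (m , _) = m

    preimage-N : ∀ x (n' : N' x) → N (preimage x n')
    preimage-N (x , k) n' with N'⇒ k n'
    ... | inj₁ n               = n
    ... | inj₂ (_ , _ , n , _) = n

    image∘preimage : ∀ x (n' : N' x) → image (preimage x n') (preimage-N x n') ≡ x
    image∘preimage (x , k) n' with N'⇒ k n'
    ... | inj₁ _ with T? (keep x)
    ...   | yes _ = Σ-≡ refl
    ...   | no r  = ⊥-elim (r k)
    image∘preimage (x , k) n' | inj₂ (m , r , n , b) with T? (keep m)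
    ...   | yes k' = ⊥-elim (r k')
    ...   | no r'  = Σ-≡ (sym (proj₂ (proj₂ (proj₂ (beyond-unique r' n))) x k b))

    image-injective : ∀ {a a'} (n : N a) (n' : N a') → image a n ≡ image a' n' → a ≡ a'
    image-injective {a} {a'} n n' eq with T? (keep a) | T? (keep a')
    ... | yes _ | yes _  = cong proj₁ eq
    ... | yes _ | no r'  = ⊥-elim (no-triangle n'
            (subst (Beyond a') (sym (cong proj₁ eq)) (beyond r' n')) n)
    ... | no r  | yes _  = ⊥-elim (no-triangle n (subst (Beyond a) (cong proj₁ eq) (beyond r n)) n')
    ... | no r  | no r'  = removed-unique r r' n n'

  correspondence : Correspondence N N'
  correspondence = record
    { to = image ; to-Q = image-N' ; from = preimage ; from-P = preimage-N
    ; to∘from = image∘preimage ; to-injective = image-injective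
    ; P-irrelevant = N-irrelevant ; Q-irrelevant = N'-irrelevant }

module Equality (G : Graph) where
  open Graph G
  open GraphDefs G

  ==⇒≡ : ∀ {u v} → T (u == v) → u ≡ v
  ==⇒≡ {u} {v} = toWitness {a? = u ≟ v}

  ≡⇒== : ∀ {u v} → u ≡ v → T (u == v)
  ≡⇒== {u} {v} = fromWitness {a? = u ≟ v}

  pair⇒ : ∀ {u v a b} → T ((u == a) ∧ (v == b)) → u ≡ a × v ≡ b
  pair⇒ = Data.Product.map ==⇒≡ ==⇒≡ ∘ Equivalence.to T-∧

  pair⇐ : ∀ {u v a b} → u ≡ a → v ≡ b → T ((u == a) ∧ (v == b))
  pair⇐ p q = Equivalence.from T-∧ (≡⇒== p , ≡⇒== q)

  new-edge⇒ : ∀ {u v a b} → T (adj u v ∨ ((u == a) ∧ (v == b))) → Edge u v ⊎ (u ≡ a × v ≡ b)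
  new-edge⇒ {u} {v} = map₂ pair⇒ ∘ Equivalence.to (T-∨ {adj u v})

  new-edge⇐ : ∀ {u v a b} → Edge u v ⊎ (u ≡ a × v ≡ b) → T (adj u v ∨ ((u == a) ∧ (v == b)))
  new-edge⇐ {u} {v} = Equivalence.from (T-∨ {adj u v}) ∘ map₂ (uncurry pair⇐)

  new-edges⇒ : ∀ {u v a₁ b₁ a₂ b₂} →
               T (adj u v ∨ ((u == a₁) ∧ (v == b₁)) ∨ ((u == a₂) ∧ (v == b₂))) →
               Edge u v ⊎ (u ≡ a₁ × v ≡ b₁) ⊎ (u ≡ a₂ × v ≡ b₂)
  new-edges⇒ {u} {v} {a₁} {b₁} =
    map₂ (map pair⇒ pair⇒ ∘ Equivalence.to (T-∨ {(u == a₁) ∧ (v == b₁)})) ∘ Equivalence.to (T-∨ {adj u v})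

  new-edges⇐ : ∀ {u v a₁ b₁ a₂ b₂} → Edge u v ⊎ (u ≡ a₁ × v ≡ b₁) ⊎ (u ≡ a₂ × v ≡ b₂) →
               T (adj u v ∨ ((u == a₁) ∧ (v == b₁)) ∨ ((u == a₂) ∧ (v == b₂)))
  new-edges⇐ {u} {v} {a₁} {b₁} =
    Equivalence.from (T-∨ {adj u v}) ∘
    map₂ (Equivalence.from (T-∨ {(u == a₁) ∧ (v == b₁)}) ∘ map (uncurry pair⇐) (uncurry pair⇐))

  Avoiding : V → V → V → Bool
  Avoiding a b v = not ((v == a) ∨ (v == b))

  Avoiding⇒≢ˡ : ∀ {a b v} → T (Avoiding a b v) → v ≢ a
  Avoiding⇒≢ˡ {a} {b} {v} k refl with v ≟ v
  ... | yes _ = k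
  ... | no v≢v = v≢v refl

  Avoiding⇒≢ʳ : ∀ {a b v} → T (Avoiding a b v) → v ≢ b
  Avoiding⇒≢ʳ {a} {b} {v} k refl with v ≟ a | v ≟ v
  ... | yes _ | _     = k
  ... | no _  | yes _ = k
  ... | no _  | no v≢v = v≢v refl

  ≢⇒Avoiding : ∀ {a b v} → v ≢ a → v ≢ b → T (Avoiding a b v)
  ≢⇒Avoiding {a} {b} {v} v≢a v≢b with v ≟ a | v ≟ b
  ... | yes v≡a | _       = v≢a v≡a
  ... | no _    | yes v≡b = v≢b v≡b
  ... | no _    | no _    = tt

  ¬Avoiding : ∀ {a b v} → ¬ T (Avoiding a b v) → v ≡ a ⊎ v ≡ b
  ¬Avoiding {a} {b} {v} r with v ≟ a | v ≟ b
  ... | yes v≡a | _       = inj₁ v≡a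
  ... | no _    | yes v≡b = inj₂ v≡b
  ... | no _    | no _    = ⊥-elim (r tt)

  ¬Avoidingˡ : ∀ {a b} → ¬ T (Avoiding a b a)
  ¬Avoidingˡ k = Avoiding⇒≢ˡ k refl

  ¬Avoidingʳ : ∀ {a b} → ¬ T (Avoiding a b b)
  ¬Avoidingʳ k = Avoiding⇒≢ʳ k refl

module AcyclicGraph (G : Graph) (acyclic : GraphDefs.Acyclic G) where
  open Graph G
  open GraphDefs G

  ¬loop : ∀ {u} → ¬ Edge u u
  ¬loop {u} e = acyclic u u e []

  ¬2-cycle : ∀ {u v} → Edge u v → ¬ Edge v u
  ¬2-cycle {u} {v} e f = acyclic u v e (f ∷ [])

  Edge⇒≢ : ∀ {u v} → Edge u v → u ≢ v
  Edge⇒≢ e refl = ¬loop e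

  InDeg1⇒¬IsShortcut : ∀ {u v} → InDeg1 v → ¬ IsShortcut u v
  InDeg1⇒¬IsShortcut {u} {v} one (e , p , avoids) =
    ¬loop (subst (λ z → Edge z v) (start≡target p avoids) e)
    where
    start≡target : ∀ {a} (p : Path a v) → Avoids u v p → a ≡ v
    start≡target [] _ = refl
    start≡target (e' ∷ p') (n , avoids') with start≡target p' avoids'
    ... | refl = ⊥-elim (n (Degree.One-unique _ one e' e , refl))

  module _ (finite : Finite) (Q : V → Set)
           (Q-parent : ∀ v → Q v → Σ V λ u → Edge u v × Q u) where

    private
      module Ancestors (v : V) (q : Q v) where

        ancestor-with-Q : ℕ → Σ V Q
        ancestor-with-Q zero    = v , q
        ancestor-with-Q (suc n) with Q-parent _ (proj₂ (ancestor-with-Q n))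
        ... | u , _ , qu = u , qu

        ancestor : ℕ → V
        ancestor = proj₁ ∘ ancestor-with-Q

        ancestor-edge : ∀ n → Edge (ancestor (suc n)) (ancestor n)
        ancestor-edge n with Q-parent _ (proj₂ (ancestor-with-Q n))
        ... | _ , e , _ = e

        descent : ∀ i k → Path (ancestor (k + i)) (ancestor i)
        descent i zero    = []
        descent i (suc k) = ancestor-edge (k + i) ∷ descent i k

        ancestors-distinct : ∀ i k → ancestor i ≢ ancestor (suc (k + i))
        ancestors-distinct i k eq =
          acyclic _ _ (ancestor-edge (k + i)) (subst (Path (ancestor (k + i))) eq (descent i k))

        -- Following parents for longer than there are vertices revisits a vertex.
        revisit : ⊥
        revisit with pigeonhole (n<1+n (length (proj₁ finite)))
                                (λ i → index (proj₂ finite (ancestor (toℕ i))))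
        ... | i , j , i<j , same-position with m≤n⇒∃[o]m+o≡n i<j
        ... | k , i+k≡j = ancestors-distinct (toℕ i) k
          (subst (λ n → ancestor (toℕ i) ≡ ancestor n)
                 (trans (sym i+k≡j) (cong suc (+-comm (toℕ i) k)))
                 (index-injective (setoid V) (proj₂ finite _) (proj₂ finite _) same-position))

    parent-closed⇒empty : ∀ v → ¬ Q v
    parent-closed⇒empty v q = Ancestors.revisit v q

module NormalNetwork (G : Graph) (normal : GraphDefs.IsNormal G) where
  open Graph G
  open GraphDefs G
  open IsPhylogeneticNetwork (proj₁ normal) public
  open AcyclicGraph G acyclic public

  treeChild : IsTreeChild
  treeChild = proj₁ (proj₂ normal)

  noShortcut : ∀ u v → ¬ IsShortcut u v
  noShortcut = proj₂ (proj₂ normal)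

  ¬triangle : ∀ {a x v} → Edge a x → Edge x v → ¬ Edge a v
  ¬triangle {a} {x} {v} e₁ e₂ e₃ =
    noShortcut a v (e₃ , (e₁ ∷ (e₂ ∷ [])) , (λ { (_ , refl) → ¬loop e₂ }) ,
                                            (λ { (refl , _) → ¬loop e₁ }) , tt)

  Edge⇒≢root : ∀ {u v} → Edge u v → v ≢ root
  Edge⇒≢root {u} e refl = root-in u e

  InDeg1⇒¬IsReticulation : ∀ {v} → InDeg1 v → ¬ IsReticulation v
  InDeg1⇒¬IsReticulation one (two , _) = Degree.One⇒¬Two _ one two

  InDeg0⇒≡root : ∀ {v} → InDeg0 v → v ≡ root
  InDeg0⇒≡root {v} none with classify v
  ... | inj₁ v≡root                                  = v≡root
  ... | inj₂ (inj₁ (_ , (u , e , _)))                = ⊥-elim (none u e)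
  ... | inj₂ (inj₂ (inj₁ ((u , e , _) , _)))         = ⊥-elim (none u e)
  ... | inj₂ (inj₂ (inj₂ ((u , _ , _ , e , _) , _))) = ⊥-elim (none u e)

  ≢root⇒parent : ∀ {v} → v ≢ root → Σ V λ u → Edge u v
  ≢root⇒parent {v} v≢root with classify v
  ... | inj₁ v≡root                                  = ⊥-elim (v≢root v≡root)
  ... | inj₂ (inj₁ (_ , (u , e , _)))                = u , e
  ... | inj₂ (inj₂ (inj₁ ((u , e , _) , _)))         = u , e
  ... | inj₂ (inj₂ (inj₂ ((u , _ , _ , e , _) , _))) = u , e

  IsLeaf⇒InDeg1 : ∀ {u v} → IsLeaf v → Edge u v → InDeg1 v
  IsLeaf⇒InDeg1 {u} {v} leaf e with classify v
  ... | inj₁ refl                                     = ⊥-elim (root-in u e)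
  ... | inj₂ (inj₁ (_ , one))                         = one
  ... | inj₂ (inj₂ (inj₁ (_ , (c , _ , _ , e' , _)))) = ⊥-elim (leaf c e')
  ... | inj₂ (inj₂ (inj₂ (_ , (c , e' , _))))         = ⊥-elim (leaf c e')

  tree-or-leaf⇒InDeg1 : ∀ {u v} → Edge u v → IsTreeVertex v ⊎ IsLeaf v → InDeg1 v
  tree-or-leaf⇒InDeg1 e (inj₁ tree) = proj₁ tree
  tree-or-leaf⇒InDeg1 e (inj₂ leaf) = IsLeaf⇒InDeg1 leaf e

  InDeg1⇒tree-or-leaf : ∀ {v} → InDeg1 v → IsTreeVertex v ⊎ IsLeaf v
  InDeg1⇒tree-or-leaf {v} one with classify v
  ... | inj₁ refl                  = ⊥-elim (root-in (proj₁ one) (proj₁ (proj₂ one)))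
  ... | inj₂ (inj₁ (leaf , _))     = inj₂ leaf
  ... | inj₂ (inj₂ (inj₁ tree))    = inj₁ tree
  ... | inj₂ (inj₂ (inj₂ (two , _))) = ⊥-elim (Degree.One⇒¬Two _ one two)

  children⇒OutDeg2 : ∀ {v a b} → Edge v a → Edge v b → a ≢ b → OutDeg2 v
  children⇒OutDeg2 {v} {a} ea eb a≢b with classify v
  ... | inj₁ refl with root-out
  ...   | inj₁ two           = two
  ...   | inj₂ (none , _)    = ⊥-elim (none a ea)
  children⇒OutDeg2 ea eb a≢b | inj₂ (inj₁ (leaf , _))       = ⊥-elim (leaf _ ea)
  children⇒OutDeg2 ea eb a≢b | inj₂ (inj₂ (inj₁ (_ , two))) = two
  children⇒OutDeg2 ea eb a≢b | inj₂ (inj₂ (inj₂ (_ , one))) =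
    ⊥-elim (a≢b (Degree.One-unique _ one ea eb))

  children-cases : ∀ {v a b c} → Edge v a → Edge v b → a ≢ b → Edge v c → c ≡ a ⊎ c ≡ b
  children-cases ea eb a≢b = Degree.Two-cases _ (children⇒OutDeg2 ea eb a≢b) ea eb a≢b

  parent-children⇒InDeg1 : ∀ {u v a b} → Edge u v → Edge v a → Edge v b → a ≢ b → InDeg1 v
  parent-children⇒InDeg1 {u} {v} e ea eb a≢b with classify v
  ... | inj₁ refl                    = ⊥-elim (root-in u e)
  ... | inj₂ (inj₁ (leaf , _))       = ⊥-elim (leaf _ ea)
  ... | inj₂ (inj₂ (inj₁ (one , _))) = one
  ... | inj₂ (inj₂ (inj₂ (_ , one))) = ⊥-elim (a≢b (Degree.One-unique _ one ea eb))

  reticulation-child-InDeg1 : ∀ {r b} → IsReticulation r → Edge r b → InDeg1 b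
  reticulation-child-InDeg1 (_ , one) e with treeChild _ (λ leaf → leaf _ e)
  ... | c , ec , tree-or-leaf with Degree.One-unique _ one ec e
  ... | refl = tree-or-leaf⇒InDeg1 ec tree-or-leaf

  -- The tree-child witness of u cannot be the reticulation r.
  reticulation-sibling-InDeg1 : ∀ {u r b} → Edge u r → IsReticulation r → Edge u b → b ≢ r →
                                InDeg1 b
  reticulation-sibling-InDeg1 er ret eb b≢r with treeChild _ (λ leaf → leaf _ er)
  ... | c , ec , tree-or-leaf with children-cases eb er b≢r ec
  ... | inj₁ refl = tree-or-leaf⇒InDeg1 ec tree-or-leaf
  ... | inj₂ refl = ⊥-elim (InDeg1⇒¬IsReticulation (tree-or-leaf⇒InDeg1 ec tree-or-leaf) ret)

Preserved : ∀ {c ℓ₁ ℓ₂} (M : WeightDomain c ℓ₁ ℓ₂) (G : Graph)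
            (w : Graph.V G → Graph.V G → WeightDomain.Carrier M) (G' : Graph)
            (w' : Graph.V G' → Graph.V G' → WeightDomain.Carrier M) → Set (ℓ₁ ⊔ ℓ₂)
Preserved M G w G' w' =
  GraphDefs.IsNormal G'
  × GraphDefs.Weights.IsWeighting G' M w'
  × (GraphDefs.Weights.IsEquidistant G M w → GraphDefs.Weights.IsEquidistant G' M w')
  × (GraphDefs.Weights.IsReticulationPair G M w → GraphDefs.Weights.IsReticulationPair G' M w')

module Suppression (G : Graph) (normal : GraphDefs.IsNormal G)
                   (keep : Graph.V G → Bool) (adj' : Graph.V G → Graph.V G → Bool) where
  open Graph G
  open GraphDefs G
  open Equality G
  open NormalNetwork G normal

  G' : Graph
  G' = rebuild G keep adj'

  module New = GraphDefs G'

  V' : Set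
  V' = Graph.V G'

  Kept Removed : V → Set
  Kept v    = T (keep v)
  Removed v = ¬ Kept v

  Via : V → V → Set
  Via u v = Σ V λ m → Removed m × Edge u m × Edge m v

  UniqueKept : (V → Set) → Set
  UniqueKept P = Σ V λ x → Kept x × P x × (∀ x' → Kept x' → P x' → x' ≡ x)

  record IsSuppression : Set where
    field
      adj'⇒ : ∀ {u v} → Kept u → Kept v → T (adj' u v) → Edge u v ⊎ Via u v
      adj'⇐ : ∀ {u v} → Kept u → Kept v → Edge u v ⊎ Via u v → T (adj' u v)
      unique-kept-parent     : ∀ {m b} → Removed m → Kept b → Edge m b → UniqueKept (λ a → Edge a m)
      kept-child-InDeg1      : ∀ {m b} → Removed m → Kept b → Edge m b → InDeg1 b
      unique-kept-child      : ∀ {m a} → Removed m → Kept a → Edge a m → UniqueKept (Edge m)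
      removed-children-equal : ∀ {v c₁ c₂} → Kept v → Removed c₁ → Removed c₂ →
                               Edge v c₁ → Edge v c₂ → c₁ ≡ c₂
      root-kept : Kept root

  module _ (S : IsSuppression) where
    open IsSuppression S

    module _ {v : V} (q : Kept v) where

      private
        in-correspondence : Correspondence (λ u → Edge u v) (λ x → New.Edge x (v , q))
        in-correspondence = KeptNeighbours.correspondence keep
          (λ u → Edge u v) (λ x → New.Edge x (v , q)) (λ m x → Edge x m)
          (λ k e → via-swap (adj'⇒ k q e)) (λ k e → adj'⇐ k q (via-swap e))
          (λ r e → unique-kept-parent r q e)
          (λ r r' e e' → Degree.One-unique _ (kept-child-InDeg1 r q e) e e')
          (λ e e' e'' → ¬triangle e' e e'') T-irrelevant T-irrelevant
          where
          via-swap : ∀ {E : Set} {P Q : V → Set} →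
                     E ⊎ Σ V (λ m → Removed m × P m × Q m) → E ⊎ Σ V (λ m → Removed m × Q m × P m)
          via-swap (inj₁ e)                 = inj₁ e
          via-swap (inj₂ (m , r , e₁ , e₂)) = inj₂ (m , r , e₂ , e₁)

        out-correspondence : Correspondence (Edge v) (New.Edge (v , q))
        out-correspondence = KeptNeighbours.correspondence keep
          (Edge v) (New.Edge (v , q)) Edge
          (adj'⇒ q) (adj'⇐ q) (λ r e → unique-kept-child r q e)
          (removed-children-equal q) (λ e e' e'' → ¬triangle e e' e'') T-irrelevant T-irrelevant

      InDeg0↑ : InDeg0 v → New.InDeg0 (v , q)
      InDeg0↑ = None-transport in-correspondence

      InDeg0↓ : New.InDeg0 (v , q) → InDeg0 v
      InDeg0↓ = None-transport (Correspondence-sym in-correspondence)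

      InDeg1↑ : InDeg1 v → New.InDeg1 (v , q)
      InDeg1↑ = One-transport in-correspondence

      OutDeg0↑ : OutDeg0 v → New.OutDeg0 (v , q)
      OutDeg0↑ = None-transport out-correspondence

      OutDeg0↓ : New.OutDeg0 (v , q) → OutDeg0 v
      OutDeg0↓ = None-transport (Correspondence-sym out-correspondence)

      OutDeg2↑ : OutDeg2 v → New.OutDeg2 (v , q)
      OutDeg2↑ = Two-transport out-correspondence

      IsTreeVertex↑ : IsTreeVertex v → New.IsTreeVertex (v , q)
      IsTreeVertex↑ (one , two) = InDeg1↑ one , OutDeg2↑ two

      IsReticulation↑ : IsReticulation v → New.IsReticulation (v , q)
      IsReticulation↑ (two , one) =
        Two-transport in-correspondence two , One-transport out-correspondence one

      IsReticulation↓ : New.IsReticulation (v , q) → IsReticulation v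
      IsReticulation↓ (two , one) =
        Two-transport (Correspondence-sym in-correspondence) two ,
        One-transport (Correspondence-sym out-correspondence) one

      tree-or-leaf↑ : IsTreeVertex v ⊎ IsLeaf v → New.IsTreeVertex (v , q) ⊎ New.IsLeaf (v , q)
      tree-or-leaf↑ (inj₁ tree) = inj₁ (IsTreeVertex↑ tree)
      tree-or-leaf↑ (inj₂ leaf) = inj₂ (OutDeg0↑ leaf)

    kept : List V → List V'
    kept []       = []
    kept (x ∷ xs) with T? (keep x)
    ... | yes k = (x , k) ∷ kept xs
    ... | no _  = kept xs

    ∈-kept : ∀ {v} (k : Kept v) {xs} → v ∈ xs → (v , k) ∈ kept xs
    ∈-kept k {x ∷ _} (here refl) with T? (keep x)
    ... | yes _ = here (Σ-≡ refl)
    ... | no r  = ⊥-elim (r k)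
    ∈-kept k {x ∷ _} (there v∈xs) with T? (keep x)
    ... | yes _ = there (∈-kept k v∈xs)
    ... | no _  = ∈-kept k v∈xs

    lift : ∀ {x y} → New.Path x y → Path (proj₁ x) (proj₁ y)
    lift New.[] = []
    lift (New._∷_ {u} {v} e p) with adj'⇒ (proj₂ u) (proj₂ v) e
    ... | inj₁ e'               = e' ∷ lift p
    ... | inj₂ (_ , _ , e₁ , e₂) = e₁ ∷ (e₂ ∷ lift p)

    lift-Avoids : ∀ {a b} (ka : Kept a) (kb : Kept b) {x y} (p : New.Path x y) →
                  New.Avoids (a , ka) (b , kb) p → Avoids a b (lift p)
    lift-Avoids ka kb New.[] _ = tt
    lift-Avoids ka kb (New._∷_ {u} {v} e p) (n , avoids) with adj'⇒ (proj₂ u) (proj₂ v) e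
    ... | inj₁ _ = (λ { (refl , refl) → n (Σ-≡ refl , Σ-≡ refl) }) , lift-Avoids ka kb p avoids
    ... | inj₂ (_ , r , _ , _) =
      (λ { (_ , refl) → r kb }) , (λ { (refl , _) → r ka }) , lift-Avoids ka kb p avoids

    acyclic' : New.Acyclic
    acyclic' (u , ku) (v , kv) e p with adj'⇒ ku kv e
    ... | inj₁ e'                = acyclic u v e' (lift p)
    ... | inj₂ (m , _ , e₁ , e₂) = acyclic u m e₁ (e₂ ∷ lift p)

    noShortcut' : ∀ x y → ¬ New.IsShortcut x y
    noShortcut' (u , ku) (v , kv) (e , p , avoids) with adj'⇒ ku kv e
    ... | inj₁ e' = noShortcut u v (e' , lift p , lift-Avoids ku kv p avoids)
    ... | inj₂ (_ , r , _ , e₂) = AcyclicGraph.InDeg1⇒¬IsShortcut G' acyclic'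
                                    (InDeg1↑ kv (kept-child-InDeg1 r kv e₂)) (e , p , avoids)

    treeChild' : New.IsTreeChild
    treeChild' (v , q) ¬leaf with treeChild v (λ leaf → ¬leaf (OutDeg0↑ q leaf))
    ... | c , e , tree-or-leaf with T? (keep c)
    ...   | yes k = (c , k) , adj'⇐ q k (inj₁ e) , tree-or-leaf↑ k tree-or-leaf
    ...   | no r with unique-kept-child r q e
    ...     | b , kb , eb , _ = (b , kb) , adj'⇐ q kb (inj₂ (c , r , e , eb)) ,
                                tree-or-leaf↑ kb (InDeg1⇒tree-or-leaf (kept-child-InDeg1 r kb eb))

    root' : V'
    root' = root , root-kept

    isPhylogeneticNetwork' : New.IsPhylogeneticNetwork
    isPhylogeneticNetwork' = record
      { finite   = kept (proj₁ finite) , λ x → ∈-kept (proj₂ x) (proj₂ finite (proj₁ x))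
      ; acyclic  = acyclic'
      ; root     = root'
      ; root-in  = InDeg0↑ root-kept root-in
      ; root-out = root-out'
      ; classify = classify' }
      where
      root-out' : New.OutDeg2 root' ⊎ (New.OutDeg0 root' × (∀ v → v ≡ root'))
      root-out' with root-out
      ... | inj₁ two            = inj₁ (OutDeg2↑ root-kept two)
      ... | inj₂ (none , only) = inj₂ (OutDeg0↑ root-kept none , λ x → Σ-≡ (only (proj₁ x)))

      classify' : ∀ x → x ≡ root' ⊎ (New.IsLeaf x × New.InDeg1 x)
                        ⊎ New.IsTreeVertex x ⊎ New.IsReticulation x
      classify' (v , k) with classify v
      ... | inj₁ v≡root                 = inj₁ (Σ-≡ v≡root)
      ... | inj₂ (inj₁ (leaf , one))    = inj₂ (inj₁ (OutDeg0↑ k leaf , InDeg1↑ k one))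
      ... | inj₂ (inj₂ (inj₁ tree))     = inj₂ (inj₂ (inj₁ (IsTreeVertex↑ k tree)))
      ... | inj₂ (inj₂ (inj₂ ret))      = inj₂ (inj₂ (inj₂ (IsReticulation↑ k ret)))

    isNormal' : New.IsNormal
    isNormal' = isPhylogeneticNetwork' , treeChild' , noShortcut'

    module Weighted {c ℓ₁ ℓ₂} (M : WeightDomain c ℓ₁ ℓ₂) where
      open WeightDomain M
      open WeightDomainProperties M
      open Weights M
      module New-Weights = New.Weights M

      module _ (w : V → V → Carrier) (w' : V' → V' → Carrier)
        (w'-edge : ∀ {u v} (ku : Kept u) (kv : Kept v) → Edge u v → w' (u , ku) (v , kv) ≈ w u v)
        (w'-via : ∀ {u v m} (ku : Kept u) (kv : Kept v) → Removed m → Edge u m → Edge m v →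
                  w' (u , ku) (v , kv) ≈ w u m ∙ w m v)
        where

        lift-pathWeight : ∀ {x y} (p : New.Path x y) →
                          New-Weights.pathWeight w' p ≈ pathWeight w (lift p)
        lift-pathWeight New.[] = ≈-refl
        lift-pathWeight (New._∷_ {u} {v} e p) with adj'⇒ (proj₂ u) (proj₂ v) e
        ... | inj₁ e' = ∙-cong (w'-edge _ _ e') (lift-pathWeight p)
        ... | inj₂ (_ , r , e₁ , e₂) =
          ≈-trans (∙-cong (w'-via _ _ r e₁ e₂) (lift-pathWeight p)) (assoc _ _ _)

        isWeighting' : IsWeighting w → New-Weights.IsWeighting w'
        isWeighting' isWeighting = record { nonneg = nonneg' ; tree-pos = tree-pos' }
          where
          open IsWeighting isWeighting

          nonneg' : ∀ x y → New.Edge x y → ε ≤ w' x y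
          nonneg' (u , ku) (v , kv) e with adj'⇒ ku kv e
          ... | inj₁ e' = ε≤-resp-≈ (nonneg u v e') (w'-edge ku kv e')
          ... | inj₂ (m , r , e₁ , e₂) =
            ε≤-resp-≈ (∙-nonneg (nonneg u m e₁) (nonneg m v e₂)) (w'-via ku kv r e₁ e₂)

          tree-pos' : ∀ x y → New.Edge x y → ¬ New.IsReticulation y → ε < w' x y
          tree-pos' (u , ku) (v , kv) e ¬ret with adj'⇒ ku kv e
          ... | inj₁ e' = ε<-resp-≈ (tree-pos u v e' (¬ret ∘ IsReticulation↑ kv)) (w'-edge ku kv e')
          ... | inj₂ (m , r , e₁ , e₂) =
            ε<-resp-≈ (∙-pos (nonneg u m e₁)
                             (tree-pos m v e₂ (InDeg1⇒¬IsReticulation (kept-child-InDeg1 r kv e₂))))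
                      (w'-via ku kv r e₁ e₂)

        isEquidistant' : IsEquidistant w → New-Weights.IsEquidistant w'
        isEquidistant' equidistant (r , kr) none (l₁ , k₁) (l₂ , k₂) leaf₁ leaf₂ p₁ p₂ =
          ≈-trans (lift-pathWeight p₁)
            (≈-trans (equidistant r (InDeg0↓ kr none) l₁ l₂ (OutDeg0↓ k₁ leaf₁) (OutDeg0↓ k₂ leaf₂)
                                  (lift p₁) (lift p₂))
                     (≈-sym (lift-pathWeight p₂)))

        private
          edge-into-reticulation : ∀ {u v} (ku : Kept u) (kv : Kept v) →
                                   New.Edge (u , ku) (v , kv) → IsReticulation v → Edge u v
          edge-into-reticulation ku kv e ret with adj'⇒ ku kv e
          ... | inj₁ e'               = e'
          ... | inj₂ (_ , r , _ , e₂) =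
            ⊥-elim (InDeg1⇒¬IsReticulation (kept-child-InDeg1 r kv e₂) ret)

        isReticulationPair' : IsReticulationPair w → New-Weights.IsReticulationPair w'
        isReticulationPair' pair (v , kv) ret' (u₁ , k₁) (u₂ , k₂) e₁ e₂ =
          ≈-trans (w'-edge k₁ kv e₁')
            (≈-trans (pair v ret u₁ u₂ e₁' e₂') (≈-sym (w'-edge k₂ kv e₂')))
          where
          ret : IsReticulation v
          ret = IsReticulation↓ kv ret'

          e₁' : Edge u₁ v
          e₁' = edge-into-reticulation k₁ kv e₁ ret

          e₂' : Edge u₂ v
          e₂' = edge-into-reticulation k₂ kv e₂ ret

        preserved : IsWeighting w → Preserved M G w G' w'
        preserved isWeighting =
          isNormal' , isWeighting' isWeighting , isEquidistant' , isReticulationPair'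

module _ (G : Graph) (normal : GraphDefs.IsNormal G) where
  open Graph G
  open GraphDefs G
  open Equality G
  open NormalNetwork G normal

  -- Cutting and isolating both delete an edge m₁ → m₂ from a tree vertex m₁ into a
  -- reticulation m₂ and suppress m₁ and m₂, creating the edges a₁ → b₁ and a₂ → b₂.
  module DetachReticulationEdge
    {m₁ m₂ a₁ b₁ a₂ b₂ : V}
    (a₁m₁ : Edge a₁ m₁) (m₁b₁ : Edge m₁ b₁) (m₁m₂ : Edge m₁ m₂)
    (a₂m₂ : Edge a₂ m₂) (m₂b₂ : Edge m₂ b₂)
    (ret : IsReticulation m₂) (b₁≢m₂ : b₁ ≢ m₂) (a₂≢m₁ : a₂ ≢ m₁)
    (adj' : V → V → Bool)
    (adj'⇒ : ∀ {u v} → T (adj' u v) → Edge u v ⊎ (u ≡ a₁ × v ≡ b₁) ⊎ (u ≡ a₂ × v ≡ b₂))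
    (adj'⇐ : ∀ {u v} → Edge u v ⊎ (u ≡ a₁ × v ≡ b₁) ⊎ (u ≡ a₂ × v ≡ b₂) → T (adj' u v))
    where
    open Suppression G normal (Avoiding m₁ m₂) adj'

    parent-of-m₁ : ∀ {u} → Edge u m₁ → u ≡ a₁
    parent-of-m₁ e = Degree.One-unique _ (parent-children⇒InDeg1 a₁m₁ m₁b₁ m₁m₂ b₁≢m₂) e a₁m₁

    kept-child-of-m₁ : ∀ {v} → Kept v → Edge m₁ v → v ≡ b₁
    kept-child-of-m₁ kv e with children-cases m₁b₁ m₁m₂ b₁≢m₂ e
    ... | inj₁ v≡b₁ = v≡b₁
    ... | inj₂ v≡m₂ = ⊥-elim (Avoiding⇒≢ʳ kv v≡m₂)

    kept-parent-of-m₂ : ∀ {u} → Kept u → Edge u m₂ → u ≡ a₂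
    kept-parent-of-m₂ ku e with Degree.Two-cases _ (proj₁ ret) m₁m₂ a₂m₂ (a₂≢m₁ ∘ sym) e
    ... | inj₁ u≡m₁ = ⊥-elim (Avoiding⇒≢ˡ ku u≡m₁)
    ... | inj₂ u≡a₂ = u≡a₂

    child-of-m₂ : ∀ {v} → Edge m₂ v → v ≡ b₂
    child-of-m₂ e = Degree.One-unique _ (proj₂ ret) e m₂b₂

    a₁≢a₂ : a₁ ≢ a₂
    a₁≢a₂ refl = ¬triangle a₁m₁ m₁m₂ a₂m₂

    kept-a₁ : Kept a₁
    kept-a₁ = ≢⇒Avoiding (Edge⇒≢ a₁m₁) (λ { refl → ¬2-cycle a₁m₁ m₁m₂ })

    kept-b₁ : Kept b₁
    kept-b₁ = ≢⇒Avoiding (Edge⇒≢ m₁b₁ ∘ sym) b₁≢m₂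

    kept-a₂ : Kept a₂
    kept-a₂ = ≢⇒Avoiding a₂≢m₁ (Edge⇒≢ a₂m₂)

    kept-b₂ : Kept b₂
    kept-b₂ = ≢⇒Avoiding (λ { refl → ¬2-cycle m₁m₂ m₂b₂ }) (Edge⇒≢ m₂b₂ ∘ sym)

    isSuppression : IsSuppression
    isSuppression = record
      { adj'⇒ = λ _ _ h → via (adj'⇒ h)
      ; adj'⇐ = λ ku kv → adj'⇐ ∘ map₂ (new ku kv)
      ; unique-kept-parent = unique-kept-parent
      ; kept-child-InDeg1 = kept-child-InDeg1
      ; unique-kept-child = unique-kept-child
      ; removed-children-equal = removed-children-equal
      ; root-kept = ≢⇒Avoiding (Edge⇒≢root a₁m₁ ∘ sym) (Edge⇒≢root a₂m₂ ∘ sym) }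
      where
      via : ∀ {u v} → Edge u v ⊎ (u ≡ a₁ × v ≡ b₁) ⊎ (u ≡ a₂ × v ≡ b₂) → Edge u v ⊎ Via u v
      via (inj₁ e)                  = inj₁ e
      via (inj₂ (inj₁ (refl , refl))) = inj₂ (m₁ , ¬Avoidingˡ , a₁m₁ , m₁b₁)
      via (inj₂ (inj₂ (refl , refl))) = inj₂ (m₂ , ¬Avoidingʳ , a₂m₂ , m₂b₂)

      new : ∀ {u v} → Kept u → Kept v → Via u v → (u ≡ a₁ × v ≡ b₁) ⊎ (u ≡ a₂ × v ≡ b₂)
      new ku kv (m , r , e₁ , e₂) with ¬Avoiding r
      ... | inj₁ refl = inj₁ (parent-of-m₁ e₁ , kept-child-of-m₁ kv e₂)
      ... | inj₂ refl = inj₂ (kept-parent-of-m₂ ku e₁ , child-of-m₂ e₂)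

      unique-kept-parent : ∀ {m b} → Removed m → Kept b → Edge m b → UniqueKept (λ a → Edge a m)
      unique-kept-parent r _ _ with ¬Avoiding r
      ... | inj₁ refl = a₁ , kept-a₁ , a₁m₁ , λ _ _ e → parent-of-m₁ e
      ... | inj₂ refl = a₂ , kept-a₂ , a₂m₂ , λ _ ku e → kept-parent-of-m₂ ku e

      kept-child-InDeg1 : ∀ {m b} → Removed m → Kept b → Edge m b → InDeg1 b
      kept-child-InDeg1 r kb e with ¬Avoiding r
      ... | inj₁ refl rewrite kept-child-of-m₁ kb e =
        reticulation-sibling-InDeg1 m₁m₂ ret m₁b₁ b₁≢m₂
      ... | inj₂ refl rewrite child-of-m₂ e         = reticulation-child-InDeg1 ret m₂b₂

      unique-kept-child : ∀ {m a} → Removed m → Kept a → Edge a m → UniqueKept (Edge m)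
      unique-kept-child r _ _ with ¬Avoiding r
      ... | inj₁ refl = b₁ , kept-b₁ , m₁b₁ , λ _ kv e → kept-child-of-m₁ kv e
      ... | inj₂ refl = b₂ , kept-b₂ , m₂b₂ , λ _ _ e → child-of-m₂ e

      removed-children-equal : ∀ {v c₁ c₂} → Kept v → Removed c₁ → Removed c₂ →
                               Edge v c₁ → Edge v c₂ → c₁ ≡ c₂
      removed-children-equal kv r₁ r₂ e₁ e₂ with ¬Avoiding r₁ | ¬Avoiding r₂
      ... | inj₁ refl | inj₁ refl = refl
      ... | inj₂ refl | inj₂ refl = refl
      ... | inj₁ refl | inj₂ refl =
        ⊥-elim (a₁≢a₂ (trans (sym (parent-of-m₁ e₁)) (kept-parent-of-m₂ kv e₂)))
      ... | inj₂ refl | inj₁ refl =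
        ⊥-elim (a₁≢a₂ (trans (sym (parent-of-m₁ e₂)) (kept-parent-of-m₂ kv e₁)))

    preserved : ∀ {c ℓ₁ ℓ₂} (M : WeightDomain c ℓ₁ ℓ₂) → let open WeightDomain M in
      (w : V → V → Carrier) (w' : V' → V' → Carrier) →
      (∀ {u v} (ku : Kept u) (kv : Kept v) → ¬ (u ≡ a₁ × v ≡ b₁) → ¬ (u ≡ a₂ × v ≡ b₂) →
         w' (u , ku) (v , kv) ≈ w u v) →
      (∀ k k' → w' (a₁ , k) (b₁ , k') ≈ w a₁ m₁ ∙ w m₁ b₁) →
      (∀ k k' → w' (a₂ , k) (b₂ , k') ≈ w a₂ m₂ ∙ w m₂ b₂) →
      Weights.IsWeighting M w → Preserved M G w G' w'
    preserved M w w' w'-old w'-new₁ w'-new₂ =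
      Weighted.preserved isSuppression M w w' w'-edge w'-via
      where
      open WeightDomain M

      w'-edge : ∀ {u v} (ku : Kept u) (kv : Kept v) → Edge u v → w' (u , ku) (v , kv) ≈ w u v
      w'-edge ku kv e = w'-old ku kv (λ { (refl , refl) → ¬triangle a₁m₁ m₁b₁ e })
                                     (λ { (refl , refl) → ¬triangle a₂m₂ m₂b₂ e })

      w'-via : ∀ {u v m} (ku : Kept u) (kv : Kept v) → Removed m → Edge u m → Edge m v →
               w' (u , ku) (v , kv) ≈ w u m ∙ w m v
      w'-via ku kv r e₁ e₂ with ¬Avoiding r
      ... | inj₁ refl with parent-of-m₁ e₁ | kept-child-of-m₁ kv e₂
      ...   | refl | refl = w'-new₁ ku kv
      w'-via ku kv r e₁ e₂ | inj₂ refl with kept-parent-of-m₂ ku e₁ | child-of-m₂ e₂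
      ...   | refl | refl = w'-new₂ ku kv

  module ReduceCherry {c ℓ₁ ℓ₂} (M : WeightDomain c ℓ₁ ℓ₂)
    (w : V → V → WeightDomain.Carrier M)
    {s t ps gs : V} (leaf-s : IsLeaf s) (leaf-t : IsLeaf t) (s≢t : s ≢ t)
    (ps-s : Edge ps s) (ps-t : Edge ps t) (gs-ps : Edge gs ps)
    where
    open Operations M G w using (reduceGraph; reduceWeight; newEdge)
    open Suppression G normal (Avoiding t ps) (λ u v → adj u v ∨ newEdge (just gs) s u v)
    open WeightDomain M
    open WeightDomainProperties M using (≈-reflexive)

    parent-of-ps : ∀ {u} → Edge u ps → u ≡ gs
    parent-of-ps e = Degree.One-unique _ (parent-children⇒InDeg1 gs-ps ps-s ps-t s≢t) e gs-ps

    kept-child-of-ps : ∀ {v} → Kept v → Edge ps v → v ≡ s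
    kept-child-of-ps kv e with children-cases ps-s ps-t s≢t e
    ... | inj₁ v≡s = v≡s
    ... | inj₂ v≡t = ⊥-elim (Avoiding⇒≢ˡ kv v≡t)

    parent-of-t : ∀ {u} → Edge u t → u ≡ ps
    parent-of-t e = Degree.One-unique _ (IsLeaf⇒InDeg1 leaf-t ps-t) e ps-t

    kept-gs : Kept gs
    kept-gs = ≢⇒Avoiding (λ { refl → leaf-t ps gs-ps }) (Edge⇒≢ gs-ps)

    kept-s : Kept s
    kept-s = ≢⇒Avoiding s≢t (Edge⇒≢ ps-s ∘ sym)

    isSuppression : IsSuppression
    isSuppression = record
      { adj'⇒ = λ _ _ h → via (new-edge⇒ h)
      ; adj'⇐ = λ _ kv → new-edge⇐ ∘ map₂ (new kv)
      ; unique-kept-parent = unique-kept-parent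
      ; kept-child-InDeg1 = kept-child-InDeg1
      ; unique-kept-child = unique-kept-child
      ; removed-children-equal = removed-children-equal
      ; root-kept = ≢⇒Avoiding (Edge⇒≢root ps-t ∘ sym) (Edge⇒≢root gs-ps ∘ sym) }
      where
      via : ∀ {u v} → Edge u v ⊎ (u ≡ gs × v ≡ s) → Edge u v ⊎ Via u v
      via (inj₁ e)             = inj₁ e
      via (inj₂ (refl , refl)) = inj₂ (ps , ¬Avoidingʳ , gs-ps , ps-s)

      new : ∀ {u v} → Kept v → Via u v → u ≡ gs × v ≡ s
      new kv (m , r , e₁ , e₂) with ¬Avoiding r
      ... | inj₁ refl = ⊥-elim (leaf-t _ e₂)
      ... | inj₂ refl = parent-of-ps e₁ , kept-child-of-ps kv e₂

      unique-kept-parent : ∀ {m b} → Removed m → Kept b → Edge m b → UniqueKept (λ a → Edge a m)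
      unique-kept-parent r _ e with ¬Avoiding r
      ... | inj₁ refl = ⊥-elim (leaf-t _ e)
      ... | inj₂ refl = gs , kept-gs , gs-ps , λ _ _ e' → parent-of-ps e'

      kept-child-InDeg1 : ∀ {m b} → Removed m → Kept b → Edge m b → InDeg1 b
      kept-child-InDeg1 r kb e with ¬Avoiding r
      ... | inj₁ refl = ⊥-elim (leaf-t _ e)
      ... | inj₂ refl rewrite kept-child-of-ps kb e = IsLeaf⇒InDeg1 leaf-s ps-s

      unique-kept-child : ∀ {m a} → Removed m → Kept a → Edge a m → UniqueKept (Edge m)
      unique-kept-child r ka e with ¬Avoiding r
      ... | inj₁ refl = ⊥-elim (Avoiding⇒≢ʳ ka (parent-of-t e))
      ... | inj₂ refl = s , kept-s , ps-s , λ _ kv e' → kept-child-of-ps kv e'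

      removed-children-equal : ∀ {v c₁ c₂} → Kept v → Removed c₁ → Removed c₂ →
                               Edge v c₁ → Edge v c₂ → c₁ ≡ c₂
      removed-children-equal kv r₁ r₂ e₁ e₂ with ¬Avoiding r₁ | ¬Avoiding r₂
      ... | inj₁ refl | _         = ⊥-elim (Avoiding⇒≢ʳ kv (parent-of-t e₁))
      ... | inj₂ refl | inj₁ refl = ⊥-elim (Avoiding⇒≢ʳ kv (parent-of-t e₂))
      ... | inj₂ refl | inj₂ refl = refl

    preserved : Weights.IsWeighting M w →
                Preserved M G w (reduceGraph s t ps (just gs)) (reduceWeight s t ps (just gs))
    preserved = Weighted.preserved isSuppression M w (reduceWeight s t ps (just gs)) w'-edge w'-via
      where
      w'-edge : ∀ {u v} (ku : Kept u) (kv : Kept v) → Edge u v →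
                reduceWeight s t ps (just gs) (u , ku) (v , kv) ≈ w u v
      w'-edge ku kv e = ≈-reflexive (if-¬T λ p → new-edge-not-old (pair⇒ p))
        where
        new-edge-not-old : ¬ (_ ≡ gs × _ ≡ s)
        new-edge-not-old (refl , refl) = ¬triangle gs-ps ps-s e

      w'-via : ∀ {u v m} (ku : Kept u) (kv : Kept v) → Removed m → Edge u m → Edge m v →
               reduceWeight s t ps (just gs) (u , ku) (v , kv) ≈ w u m ∙ w m v
      w'-via ku kv r e₁ e₂ with ¬Avoiding r
      ... | inj₁ refl = ⊥-elim (leaf-t _ e₂)
      ... | inj₂ refl with parent-of-ps e₁ | kept-child-of-ps kv e₂
      ...   | refl | refl = ≈-reflexive (if-T (pair⇐ refl refl))

  module ReduceCherryAtRoot {c ℓ₁ ℓ₂} (M : WeightDomain c ℓ₁ ℓ₂)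
    (w : V → V → WeightDomain.Carrier M)
    {s t ps : V} (leaf-s : IsLeaf s) (leaf-t : IsLeaf t) (s≢t : s ≢ t)
    (ps-s : Edge ps s) (ps-t : Edge ps t) (ps-root : InDeg0 ps)
    where
    open Operations M G w using (reduceGraph; reduceWeight)
    open WeightDomain M using (_≈_; ε)
    open WeightDomainProperties M using (≈-refl; ≈-sym; ≈-trans)

    G' : Graph
    G' = reduceGraph s t ps nothing

    module New = GraphDefs G'

    -- A kept vertex other than s has a kept parent other than s, which cannot go on forever.
    kept⇒≡s : ∀ v → T (Avoiding t ps v) → v ≡ s
    kept⇒≡s v kv with v ≟ s
    ... | yes v≡s = v≡s
    ... | no v≢s  = ⊥-elim (parent-closed⇒empty finite Q Q-parent v (kv , v≢s))
      where
      Q : V → Set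
      Q v = T (Avoiding t ps v) × v ≢ s

      ps≡root : ps ≡ root
      ps≡root = InDeg0⇒≡root ps-root

      parent-Q : ∀ {u v} → Edge u v → Q v → Q u
      parent-Q e (kv , v≢s) = ≢⇒Avoiding (λ { refl → leaf-t _ e }) u≢ps , (λ { refl → leaf-s _ e })
        where
        u≢ps : _ ≢ ps
        u≢ps refl with children-cases ps-s ps-t s≢t e
        ... | inj₁ v≡s = v≢s v≡s
        ... | inj₂ v≡t = Avoiding⇒≢ˡ kv v≡t

      Q-parent : ∀ v → Q v → Σ V λ u → Edge u v × Q u
      Q-parent v q with ≢root⇒parent (λ v≡root → Avoiding⇒≢ʳ (proj₁ q) (trans v≡root (sym ps≡root)))
      ... | u , e = u , e , parent-Q e q

    s' : Graph.V G'
    s' = s , ≢⇒Avoiding s≢t (Edge⇒≢ ps-s ∘ sym)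

    ≡s' : ∀ x → x ≡ s'
    ≡s' (v , kv) = Σ-≡ (kept⇒≡s v kv)

    ¬New-Edge : ∀ x y → ¬ New.Edge x y
    ¬New-Edge x y e with ≡s' x | ≡s' y | Equivalence.to (T-∨ {adj (proj₁ x) (proj₁ y)}) e
    ... | refl | refl | inj₁ e' = ¬loop e'

    preserved : Weights.IsWeighting M w → Preserved M G w G' (reduceWeight s t ps nothing)
    preserved _ =
      (isPhylogeneticNetwork' , (λ x ¬leaf → ⊥-elim (¬leaf (¬New-Edge x))) ,
                                λ x y shortcut → ¬New-Edge x y (proj₁ shortcut)) ,
      record { nonneg   = λ x y e → ⊥-elim (¬New-Edge x y e)
             ; tree-pos = λ x y e _ → ⊥-elim (¬New-Edge x y e) } ,
      (λ _ _ _ _ _ _ _ p₁ p₂ → ≈-trans (pathWeight≈ε p₁) (≈-sym (pathWeight≈ε p₂))) ,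
      (λ _ v _ u₁ _ e _ → ⊥-elim (¬New-Edge u₁ v e))
      where
      isPhylogeneticNetwork' : New.IsPhylogeneticNetwork
      isPhylogeneticNetwork' = record
        { finite = (s' ∷ []) , (λ x → here (≡s' x))
        ; acyclic = λ x y e _ → ¬New-Edge x y e
        ; root = s'
        ; root-in = λ x → ¬New-Edge x s'
        ; root-out = inj₂ (¬New-Edge s' , ≡s')
        ; classify = inj₁ ∘ ≡s' }

      pathWeight≈ε : ∀ {x y} (p : New.Path x y) →
                     New.Weights.pathWeight M (reduceWeight s t ps nothing) p ≈ ε
      pathWeight≈ε New.[]                = ≈-refl
      pathWeight≈ε (New._∷_ {x} {y} e _) = ⊥-elim (¬New-Edge x y e)

  module CutReticulatedCherry {c ℓ₁ ℓ₂} (M : WeightDomain c ℓ₁ ℓ₂)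
    (w : V → V → WeightDomain.Carrier M)
    {s t ps pt gs gt : V} (leaf-s : IsLeaf s) (ps-s : Edge ps s) (pt-t : Edge pt t)
    (ret : IsReticulation pt) (ps-pt : Edge ps pt)
    (gs-ps : Edge gs ps) (gt-pt : Edge gt pt) (gt≢ps : gt ≢ ps)
    where
    open Operations M G w using (cutGraph; cutWeight)
    open WeightDomainProperties M using (≈-reflexive)

    private
      s≢pt : s ≢ pt
      s≢pt refl = leaf-s t pt-t

      module Detach = DetachReticulationEdge gs-ps ps-s ps-pt gt-pt pt-t ret s≢pt gt≢ps
        (λ u v → adj u v ∨ ((u == gs) ∧ (v == s)) ∨ ((u == gt) ∧ (v == t))) new-edges⇒ new-edges⇐

    preserved : Weights.IsWeighting M w →
                Preserved M G w (cutGraph s t ps pt gs gt) (cutWeight s t ps pt gs gt)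
    preserved = Detach.preserved M w (cutWeight s t ps pt gs gt)
      (λ _ _ old₁ old₂ → ≈-reflexive (trans (if-¬T (old₁ ∘ pair⇒)) (if-¬T (old₂ ∘ pair⇒))))
      (λ _ _ → ≈-reflexive (if-T (pair⇐ refl refl)))
      (λ _ _ → ≈-reflexive (trans (if-¬T (Detach.a₁≢a₂ ∘ sym ∘ proj₁ ∘ pair⇒)) (if-T (pair⇐ refl refl))))

  module IsolateReticulatedCherry {c ℓ₁ ℓ₂} (M : WeightDomain c ℓ₁ ℓ₂)
    (w : V → V → WeightDomain.Carrier M)
    {s t ps pt gt gt' h : V} (pt-t : Edge pt t) (ret : IsReticulation pt) (ps-pt : Edge ps pt)
    (gt-pt : Edge gt pt) (gt≢ps : gt ≢ ps) (gt'-gt : Edge gt' gt) (gt-h : Edge gt h) (h≢pt : h ≢ pt)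
    where
    open Operations M G w using (isolateGraph; isolateWeight)
    open WeightDomainProperties M using (≈-reflexive)

    private
      module Detach = DetachReticulationEdge gt'-gt gt-h gt-pt ps-pt pt-t ret h≢pt (gt≢ps ∘ sym)
        (λ u v → adj u v ∨ ((u == ps) ∧ (v == t)) ∨ ((u == gt') ∧ (v == h)))
        (map₂ swap ∘ new-edges⇒) (new-edges⇐ ∘ map₂ swap)

    preserved : Weights.IsWeighting M w →
                Preserved M G w (isolateGraph s t ps pt gt gt' h) (isolateWeight s t ps pt gt gt' h)
    preserved = Detach.preserved M w (isolateWeight s t ps pt gt gt' h)
      (λ _ _ old₁ old₂ → ≈-reflexive (trans (if-¬T (old₂ ∘ pair⇒)) (if-¬T (old₁ ∘ pair⇒))))
      (λ _ _ → ≈-reflexive (trans (if-¬T (Detach.a₁≢a₂ ∘ proj₁ ∘ pair⇒)) (if-T (pair⇐ refl refl))))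
      (λ _ _ → ≈-reflexive (if-T (pair⇐ refl refl)))

lemma2 : ∀ {c ℓ₁ ℓ₂} (M : WeightDomain c ℓ₁ ℓ₂) (G : Graph)
         (w : Graph.V G → Graph.V G → WeightDomain.Carrier M)
         (s t : Graph.V G) (G' : Graph)
         (w' : Graph.V G' → Graph.V G' → WeightDomain.Carrier M) →
         GraphDefs.IsNormal G →
         GraphDefs.Weights.IsWeighting G M w →
         Operations.ObtainedBy M G w s t G' w' →
         GraphDefs.IsNormal G'
         × GraphDefs.Weights.IsWeighting G' M w'
         × (GraphDefs.Weights.IsEquidistant G M w → GraphDefs.Weights.IsEquidistant G' M w')
         × (GraphDefs.Weights.IsReticulationPair G M w → GraphDefs.Weights.IsReticulationPair G' M w')
lemma2 M G w s t _ _ normal weighted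
       (Operations.reduce ps nothing (leaf-s , leaf-t , s≢t , ps-s , ps-t) ps-root) =
  ReduceCherryAtRoot.preserved G normal M w leaf-s leaf-t s≢t ps-s ps-t ps-root weighted
lemma2 M G w s t _ _ normal weighted
       (Operations.reduce ps (just gs) (leaf-s , leaf-t , s≢t , ps-s , ps-t) gs-ps) =
  ReduceCherry.preserved G normal M w leaf-s leaf-t s≢t ps-s ps-t gs-ps weighted
lemma2 M G w s t _ _ normal weighted
       (Operations.cut ps pt gs gt (leaf-s , _ , ps-s , pt-t , ret , ps-pt) gs-ps gt-pt gt≢ps) =
  CutReticulatedCherry.preserved G normal M w leaf-s ps-s pt-t ret ps-pt gs-ps gt-pt gt≢ps weighted
lemma2 M G w s t _ _ normal weighted
       (Operations.isolate _ _ _ _ _ (_ , _ , _ , pt-t , ret , ps-pt) gt-pt gt≢ps _ gt'-gt gt-h h≢pt) =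
  IsolateReticulatedCherry.preserved G normal M w {s = s}
    pt-t ret ps-pt gt-pt gt≢ps gt'-gt gt-h h≢pt weighted
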